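{- Let $b\ge 2$ and let $(\mathcal{P},\mathcal{B})$ be a $2$-$(v,b,1)$ design, i.e. $\mathcal{P}$ is a set of $v$ points and $\mathcal{B}$ is a family of $b$-element subsets of $\mathcal{P}$ (blocks) such that every pair of distinct points lies in exactly one block. Let $(\mathcal{P}',\mathcal{B}')$ be a $2$-$(v',b,1)$ subdesign, i.e. $\mathcal{P}'\subseteq\mathcal{P}$, $\mathcal{B}'\subseteq\mathcal{B}$, every block of $\mathcal{B}'$ is contained in $\mathcal{P}'$, and $(\mathcal{P}',\mathcal{B}')$ is a $2$-$(v',b,1)$ design. Let $p_1,p_2\in\mathcal{P}'$ be distinct. Let $C_1$ be the set of blocks of $\mathcal{B}'$ containing $p_1$ but not $p_2$, and $C_2$ the set of blocks of $\mathcal{B}'$ containing $p_2$ but not $p_1$. Let $\Gamma$ be the block graph of $(\mathcal{P},\mathcal{B})$. Then $\{C_1,C_2\}$ is a switching set of $\Gamma$.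
   Context: The block graph of a $2$-$(v,b,1)$ design has the blocks as vertices, two distinct blocks being adjacent iff they intersect. For a vertex $x$ of a graph $\Gamma$, $\Gamma(x)$ denotes its neighbourhood. For a finite simple graph $\Gamma$ with vertex set $V$ and disjoint subsets $C_1,C_2\subseteq V$, put $D=V\setminus(C_1\cup C_2)$. The pair $\{C_1,C_2\}$ is called a switching set of $\Gamma$ if: $|C_1|=|C_2|$; the induced subgraphs on $C_1$, on $C_2$ and on $C_1\cup C_2$ are regular, and the induced subgraphs on $C_1$ and on $C_2$ have the same degree; and every $x\in D$ satisfies $|\Gamma(x)\cap C_1|=|\Gamma(x)\cap C_2|$ or $\Gamma(x)\cap(C_1\cup C_2)\in\{C_1,C_2\}$. -}

module Defs where

open import Data.Nat using (ℕ)
open import Data.Bool using (Bool; true; false; not; _∧_)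
open import Data.Fin using (Fin; _≟_)
open import Data.Fin.Subset using (Subset; _∈_; _∉_; _⊆_; _∩_; _∪_; ∣_∣; Nonempty)
open import Data.Fin.Subset.Properties using (_∈?_; nonempty?)
open import Data.Vec using (tabulate)
open import Data.Product using (Σ; ∃; _×_; _,_)
open import Data.Sum using (_⊎_)
open import Relation.Nullary using (¬_)
open import Relation.Nullary.Decidable using (⌊_⌋)
open import Relation.Binary.PropositionalEquality using (_≡_; _≢_)

record Graph (n : ℕ) : Set where
  field
    adj   : Fin n → Fin n → Bool
    sym   : ∀ x y → adj x y ≡ adj y x
    irrefl : ∀ x → adj x x ≡ false

open Graph public

nbhd : ∀ {n} → Graph n → Fin n → Subset n
nbhd Γ x = tabulate (λ y → adj Γ x y)

RegularOn : ∀ {n} → Graph n → Subset n → ℕ → Set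
RegularOn Γ S k = ∀ x → x ∈ S → ∣ nbhd Γ x ∩ S ∣ ≡ k

Disjoint : ∀ {n} → Subset n → Subset n → Set
Disjoint {n} A B = ∀ (x : Fin n) → x ∈ A → x ∉ B

IsSwitchingSet : ∀ {n} → Graph n → Subset n → Subset n → Set
IsSwitchingSet {n} Γ C₁ C₂ =
  Disjoint C₁ C₂ ×
  ∣ C₁ ∣ ≡ ∣ C₂ ∣ ×
  (∃ λ k → RegularOn Γ C₁ k × RegularOn Γ C₂ k) ×
  (∃ λ k → RegularOn Γ (C₁ ∪ C₂) k) ×
  (∀ (x : Fin n) → x ∉ (C₁ ∪ C₂) →
     ∣ nbhd Γ x ∩ C₁ ∣ ≡ ∣ nbhd Γ x ∩ C₂ ∣
     ⊎ nbhd Γ x ∩ (C₁ ∪ C₂) ≡ C₁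
     ⊎ nbhd Γ x ∩ (C₁ ∪ C₂) ≡ C₂)

UniqueBlockIn : ∀ {v m} → (Fin m → Subset v) → Subset m → Fin v → Fin v → Set
UniqueBlockIn {v} {m} B S x y =
  Σ (Fin m) λ i → (i ∈ S × x ∈ B i × y ∈ B i) ×
    (∀ j → j ∈ S → x ∈ B j → y ∈ B j → j ≡ i)

record IsDesign (v b m : ℕ) (B : Fin m → Subset v) : Set where
  field
    blockSize : ∀ i → ∣ B i ∣ ≡ b
    distinct  : ∀ i j → B i ≡ B j → i ≡ j      -- B is a set of blocks
    pairs     : ∀ x y → x ≢ y → UniqueBlockIn B (tabulate (λ _ → true)) x y

-- (P', B') is a 2-(|P'|,b,1) subdesign of the design with blocks B.
-- (Block size b and distinctness are inherited from the ambient design.)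
record IsSubdesign {v m : ℕ} (B : Fin m → Subset v) (P′ : Subset v) (B′ : Subset m) : Set where
  field
    blocksInside : ∀ i → i ∈ B′ → B i ⊆ P′
    pairs        : ∀ x y → x ∈ P′ → y ∈ P′ → x ≢ y → UniqueBlockIn B B′ x y

blockAdj : ∀ {v m} → (Fin m → Subset v) → Fin m → Fin m → Bool
blockAdj B i j = not ⌊ i ≟ j ⌋ ∧ ⌊ nonempty? (B i ∩ B j) ⌋

blocksThrough : ∀ {v m} → (Fin m → Subset v) → Subset m → Fin v → Fin v → Subset m
blocksThrough B B′ p q =
  tabulate (λ i → ⌊ i ∈? B′ ⌋ ∧ ⌊ p ∈? B i ⌋ ∧ not ⌊ q ∈? B i ⌋)

-- Let L be the block of the subdesign through p₁ and p₂, and P′∖L the points of P′ off L. A point y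
-- of P′∖L lies on exactly one block of C₁ (the subdesign block through p₁ and y), and a block of C₁
-- meets P′∖L in its b − 1 points other than p₁, so double counting gives
-- ∣C₁∣ (b − 1) = ∣P′∖L∣ = ∣C₂∣ (b − 1). The same correspondence, for a block x avoiding p₁, matches
-- the neighbours of x in C₁ with the points of x in P′∖L, a set that does not depend on which of
-- p₁, p₂ we started from: this balances every block through neither point, and gives b − 1
-- neighbours in C₁ for each block of C₂. Blocks of C₁ pairwise meet in p₁, a block through both
-- points meets every block of C₁ ∪ C₂, and a block outside the subdesign through p₁ alone meets all
-- of C₁ but no block of C₂, since a common point would put it in the subdesign.

module Submission where

open import Defs hiding (sym)
open import Data.Bool using (Bool; true; false; not; _∧_; _∨_)
open import Data.Fin using (Fin; _≟_)
open import Data.Fin.Subset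
  using (Subset; inside; outside; _∈_; _∉_; _∩_; _∪_; _─_; _-_; ⁅_⁆; ∣_∣; Nonempty)
open import Data.Fin.Subset.Properties
  using (_∈?_; nonempty?; ⊆-antisym; x∈⁅x⁆; x∈⁅y⁆⇒x≡y; x∉⁅y⁆⇒x≢y; ∣⁅x⁆∣≡1;
         x∈p∩q⁺; x∈p∩q⁻; x∈p∪q⁺; x∈p∪q⁻; p∩q⊆q; ∩-distribˡ-∪; ∪-comm;
         p─q⊆p; x∈p∧x∉q⇒x∈p─q; x∈p∧x≢y⇒x∈p-y)
open import Data.Nat using (ℕ; suc; _+_; _*_; _∸_; _≤_; ≢-nonZero)
open import Data.Nat.Properties
  using (+-identityʳ; *-identityʳ; +-comm; *-cancelʳ-≡; m>n⇒m∸n≢0; +-*-semiring)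
open import Data.Nat.Solver using (module +-*-Solver)
open import Data.Product using (Σ; _×_; _,_; proj₁; proj₂)
open import Data.Sum using (_⊎_; inj₁; inj₂)
open import Data.Vec using (_∷_; []; there; lookup; tabulate)
open import Data.Vec.Properties using (lookup∘tabulate; lookup-zipWith; []=⇒lookup; lookup⇒[]=)
open import Function using (_∘_; case_of_)
open import Relation.Nullary using (yes; no; contradiction)
open import Relation.Nullary.Decidable using (⌊_⌋; decidable-stable)
open import Relation.Binary.PropositionalEquality

open import Algebra.Properties.Semiring.Sum +-*-semiring
  using (sum-syntax; ∑-comm; ∑-distrib-+; sum-cong-≗; *-distribˡ-sum; *-distribʳ-sum)
open +-*-Solver using (solve; _:*_; _:=_)

private variable
  n v m : ℕ

x∈p─q⇒x∉q : ∀ {x : Fin n} (p q : Subset n) → x ∈ p ─ q → x ∉ q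
x∈p─q⇒x∉q (_ ∷ p) (_ ∷ q) (there x∈p─q) (there x∈q) = x∈p─q⇒x∉q p q x∈p─q x∈q

x∈p-y⇒x≢y : ∀ {p : Subset n} {x y} → x ∈ p - y → x ≢ y
x∈p-y⇒x≢y {p = p} {y = y} x∈p-y = x∉⁅y⁆⇒x≢y (x∈p─q⇒x∉q p ⁅ y ⁆ x∈p-y)

∈-tabulate⁺ : ∀ {f : Fin n → Bool} {i} → f i ≡ true → i ∈ tabulate f
∈-tabulate⁺ {f = f} {i} fᵢ = lookup⇒[]= i (tabulate f) (trans (lookup∘tabulate f i) fᵢ)

∈-tabulate⁻ : ∀ {f : Fin n → Bool} {i} → i ∈ tabulate f → f i ≡ true
∈-tabulate⁻ {f = f} {i} i∈ = trans (sym (lookup∘tabulate f i)) ([]=⇒lookup i∈)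

𝟙 : Bool → ℕ
𝟙 true  = 1
𝟙 false = 0

∣p∣≡∑𝟙 : (p : Subset n) → ∣ p ∣ ≡ ∑[ i < n ] 𝟙 (lookup p i)
∣p∣≡∑𝟙 []            = refl
∣p∣≡∑𝟙 (inside  ∷ p) = cong suc (∣p∣≡∑𝟙 p)
∣p∣≡∑𝟙 (outside ∷ p) = ∣p∣≡∑𝟙 p

𝟙-∧ : ∀ a b → 𝟙 (a ∧ b) ≡ 𝟙 a * 𝟙 b
𝟙-∧ true  b = sym (+-identityʳ (𝟙 b))
𝟙-∧ false b = refl

∣p∪q∣≡∣p∣+∣q∣ : (p q : Subset n) → Disjoint p q → ∣ p ∪ q ∣ ≡ ∣ p ∣ + ∣ q ∣
∣p∪q∣≡∣p∣+∣q∣ {n} p q p∩q≡∅ = begin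
  ∣ p ∪ q ∣                                             ≡⟨ ∣p∣≡∑𝟙 (p ∪ q) ⟩
  ∑[ i < n ] 𝟙 (lookup (p ∪ q) i)                       ≡⟨ sum-cong-≗ 𝟙-∨ ⟩
  ∑[ i < n ] (𝟙 (lookup p i) + 𝟙 (lookup q i))          ≡⟨ ∑-distrib-+ (𝟙 ∘ lookup p) (𝟙 ∘ lookup q) ⟩
  ∑[ i < n ] 𝟙 (lookup p i) + ∑[ i < n ] 𝟙 (lookup q i) ≡⟨ cong₂ _+_ (∣p∣≡∑𝟙 p) (∣p∣≡∑𝟙 q) ⟨
  ∣ p ∣ + ∣ q ∣                                         ∎
  where
  open ≡-Reasoning
  𝟙-∨ : ∀ i → 𝟙 (lookup (p ∪ q) i) ≡ 𝟙 (lookup p i) + 𝟙 (lookup q i)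
  𝟙-∨ i rewrite lookup-zipWith _∨_ i p q with lookup p i in pᵢ | lookup q i in qᵢ
  ... | true  | true  = contradiction (lookup⇒[]= i q qᵢ) (p∩q≡∅ i (lookup⇒[]= i p pᵢ))
  ... | true  | false = refl
  ... | false | _     = refl

∣p∣≡1 : ∀ (p : Subset n) {x} → x ∈ p → (∀ y → y ∈ p → y ≡ x) → ∣ p ∣ ≡ 1
∣p∣≡1 p {x} x∈p unique = trans (cong ∣_∣ p≡⁅x⁆) (∣⁅x⁆∣≡1 x)
  where
  p≡⁅x⁆ = ⊆-antisym (λ {y} y∈p → subst (_∈ ⁅ x ⁆) (sym (unique y y∈p)) (x∈⁅x⁆ x))
                    (λ {y} y∈⁅x⁆ → subst (_∈ _) (sym (x∈⁅y⁆⇒x≡y x y∈⁅x⁆)) x∈p)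

∣p∣≡1+∣p-x∣ : ∀ {p : Subset n} {x} → x ∈ p → ∣ p ∣ ≡ suc ∣ p - x ∣
∣p∣≡1+∣p-x∣ {p = p} {x} x∈p = begin
  ∣ p ∣                 ≡⟨ cong ∣_∣ p≡⁅x⁆∪[p-x] ⟩
  ∣ ⁅ x ⁆ ∪ (p - x) ∣   ≡⟨ ∣p∪q∣≡∣p∣+∣q∣ ⁅ x ⁆ (p - x) ⁅x⁆∩[p-x]≡∅ ⟩
  ∣ ⁅ x ⁆ ∣ + ∣ p - x ∣ ≡⟨ cong (_+ ∣ p - x ∣) (∣⁅x⁆∣≡1 x) ⟩
  suc ∣ p - x ∣         ∎
  where
  open ≡-Reasoning
  ⁅x⁆∩[p-x]≡∅ : Disjoint ⁅ x ⁆ (p - x)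
  ⁅x⁆∩[p-x]≡∅ y y∈⁅x⁆ y∈p-x = x∈p─q⇒x∉q p ⁅ x ⁆ y∈p-x y∈⁅x⁆
  p≡⁅x⁆∪[p-x] : p ≡ ⁅ x ⁆ ∪ (p - x)
  p≡⁅x⁆∪[p-x] = ⊆-antisym
    (λ {y} y∈p → x∈p∪q⁺ (case y ≟ x of λ where
       (yes refl) → inj₁ (x∈⁅x⁆ x)
       (no y≢x)   → inj₂ (x∈p∧x≢y⇒x∈p-y y∈p y≢x)))
    (λ {y} y∈ → case x∈p∪q⁻ ⁅ x ⁆ (p - x) y∈ of λ where
       (inj₁ y∈⁅x⁆) → subst (_∈ p) (sym (x∈⁅y⁆⇒x≡y x y∈⁅x⁆)) x∈p
       (inj₂ y∈p-x) → p─q⊆p p ⁅ x ⁆ y∈p-x)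

∣p∩[q∪r]∣≡∣p∩q∣+∣p∩r∣ : (p q r : Subset n) → Disjoint q r → ∣ p ∩ (q ∪ r) ∣ ≡ ∣ p ∩ q ∣ + ∣ p ∩ r ∣
∣p∩[q∪r]∣≡∣p∩q∣+∣p∩r∣ p q r q∩r≡∅ =
  trans (cong ∣_∣ (∩-distribˡ-∪ p q r))
        (∣p∪q∣≡∣p∣+∣q∣ (p ∩ q) (p ∩ r) λ x x∈p∩q x∈p∩r →
          q∩r≡∅ x (proj₂ (x∈p∩q⁻ p q x∈p∩q)) (proj₂ (x∈p∩q⁻ p r x∈p∩r)))

pencil : (Fin m → Subset v) → Fin v → Subset m
pencil B y = tabulate (λ j → lookup (B j) y)

∈-pencil⁺ : ∀ (B : Fin m → Subset v) {y j} → y ∈ B j → j ∈ pencil B y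
∈-pencil⁺ B y∈Bj = ∈-tabulate⁺ ([]=⇒lookup y∈Bj)

∈-pencil⁻ : ∀ (B : Fin m → Subset v) {y j} → j ∈ pencil B y → y ∈ B j
∈-pencil⁻ B {y} {j} j∈ = lookup⇒[]= y (B j) (∈-tabulate⁻ j∈)

∣p∩q∣≡∑𝟙*𝟙 : (p q : Subset n) → ∣ p ∩ q ∣ ≡ ∑[ i < n ] (𝟙 (lookup p i) * 𝟙 (lookup q i))
∣p∩q∣≡∑𝟙*𝟙 p q = trans (∣p∣≡∑𝟙 (p ∩ q)) (sum-cong-≗ λ i →
  trans (cong 𝟙 (lookup-zipWith _∧_ i p q)) (𝟙-∧ (lookup p i) (lookup q i)))

∑𝟙*f≡∣p∣*c : (p : Subset n) (f : Fin n → ℕ) {c : ℕ} → (∀ i → i ∈ p → f i ≡ c) →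
           ∑[ i < n ] (𝟙 (lookup p i) * f i) ≡ ∣ p ∣ * c
∑𝟙*f≡∣p∣*c {n} p f {c} f≡c = begin
  ∑[ i < n ] (𝟙 (lookup p i) * f i) ≡⟨ sum-cong-≗ f≡c-on-p ⟩
  ∑[ i < n ] (𝟙 (lookup p i) * c)   ≡⟨ *-distribʳ-sum c (𝟙 ∘ lookup p) ⟨
  (∑[ i < n ] 𝟙 (lookup p i)) * c   ≡⟨ cong (_* c) (∣p∣≡∑𝟙 p) ⟨
  ∣ p ∣ * c                         ∎
  where
  open ≡-Reasoning
  f≡c-on-p : ∀ i → 𝟙 (lookup p i) * f i ≡ 𝟙 (lookup p i) * c
  f≡c-on-p i with lookup p i in pᵢ
  ... | true  = cong (1 *_) (f≡c i (lookup⇒[]= i p pᵢ))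
  ... | false = refl

incidences : (B : Fin m → Subset v) (S : Subset v) (T : Subset m) →
  ∑[ y < v ] (𝟙 (lookup S y) * ∣ pencil B y ∩ T ∣) ≡ ∑[ j < m ] (𝟙 (lookup T j) * ∣ B j ∩ S ∣)
incidences {m} {v} B S T = begin
  ∑[ y < v ] (𝟙 (S′ y) * ∣ pencil B y ∩ T ∣)
    ≡⟨ sum-cong-≗ (λ y → trans (cong (𝟙 (S′ y) *_) (∣p∩q∣≡∑𝟙*𝟙 (pencil B y) T))
                               (*-distribˡ-sum {n = m} (𝟙 (S′ y)) _)) ⟩
  ∑[ y < v ] ∑[ j < m ] (𝟙 (S′ y) * (𝟙 (lookup (pencil B y) j) * 𝟙 (T′ j)))
    ≡⟨ ∑-comm {m = v} {n = m} _ ⟩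
  ∑[ j < m ] ∑[ y < v ] (𝟙 (S′ y) * (𝟙 (lookup (pencil B y) j) * 𝟙 (T′ j)))
    ≡⟨ sum-cong-≗ (λ j → sum-cong-≗ (λ y → rearrange (S′ y) (lookup (B j) y) (T′ j)
                                         (lookup∘tabulate (λ j → lookup (B j) y) j))) ⟩
  ∑[ j < m ] ∑[ y < v ] (𝟙 (T′ j) * (𝟙 (lookup (B j) y) * 𝟙 (S′ y)))
    ≡⟨ sum-cong-≗ (λ j → trans (sym (*-distribˡ-sum {n = v} (𝟙 (T′ j)) _))
                               (cong (𝟙 (T′ j) *_) (sym (∣p∩q∣≡∑𝟙*𝟙 (B j) S)))) ⟩
  ∑[ j < m ] (𝟙 (T′ j) * ∣ B j ∩ S ∣) ∎
  where
  open ≡-Reasoning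
  S′ = lookup S
  T′ = lookup T
  rearrange : ∀ s b t {b′} → b′ ≡ b → 𝟙 s * (𝟙 b′ * 𝟙 t) ≡ 𝟙 t * (𝟙 b * 𝟙 s)
  rearrange s b t refl = solve 3 (λ s b t → s :* (b :* t) := t :* (b :* s)) refl (𝟙 s) (𝟙 b) (𝟙 t)

double-counting : (B : Fin m → Subset v) (S : Subset v) (T : Subset m) {k : ℕ} →
  (∀ y → y ∈ S → ∣ pencil B y ∩ T ∣ ≡ 1) → (∀ j → j ∈ T → ∣ B j ∩ S ∣ ≡ k) →
  ∣ S ∣ ≡ ∣ T ∣ * k
double-counting {m} {v} B S T {k} one-block k-points = begin
  ∣ S ∣                                            ≡⟨ *-identityʳ ∣ S ∣ ⟨
  ∣ S ∣ * 1                                        ≡⟨ ∑𝟙*f≡∣p∣*c S _ one-block ⟨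
  ∑[ y < v ] (𝟙 (lookup S y) * ∣ pencil B y ∩ T ∣) ≡⟨ incidences B S T ⟩
  ∑[ j < m ] (𝟙 (lookup T j) * ∣ B j ∩ S ∣)        ≡⟨ ∑𝟙*f≡∣p∣*c T _ k-points ⟩
  ∣ T ∣ * k                                        ∎
  where open ≡-Reasoning

∈-blocksThrough⁻ : ∀ {B : Fin m → Subset v} {B′ p q j} →
  j ∈ blocksThrough B B′ p q → j ∈ B′ × p ∈ B j × q ∉ B j
∈-blocksThrough⁻ {B = B} {B′} {p} {q} {j} j∈ with j ∈? B′ | p ∈? B j | q ∈? B j | ∈-tabulate⁻ j∈
... | yes j∈B′ | yes p∈Bj | no q∉Bj | _ = j∈B′ , p∈Bj , q∉Bj
... | yes _    | yes _    | yes _   | ()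
... | yes _    | no _     | _       | ()
... | no _     | _        | _       | ()

∈-blocksThrough⁺ : ∀ {B : Fin m → Subset v} {B′ p q j} →
  j ∈ B′ → p ∈ B j → q ∉ B j → j ∈ blocksThrough B B′ p q
∈-blocksThrough⁺ {B = B} {B′} {p} {q} {j} j∈B′ p∈Bj q∉Bj = ∈-tabulate⁺ member
  where
  member : ⌊ j ∈? B′ ⌋ ∧ ⌊ p ∈? B j ⌋ ∧ not ⌊ q ∈? B j ⌋ ≡ true
  member with j ∈? B′ | p ∈? B j | q ∈? B j
  ... | yes _    | yes _    | no _     = refl
  ... | no j∉B′  | _        | _        = contradiction j∈B′ j∉B′
  ... | yes _    | no p∉Bj  | _        = contradiction p∈Bj p∉Bj
  ... | yes _    | yes _    | yes q∈Bj = contradiction q∈Bj q∉Bj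

module BlockGraph {v m} {B : Fin m → Subset v} (Γ : Graph m)
                  (Γ-blocks : ∀ i j → adj Γ i j ≡ blockAdj B i j) where

  ∈-nbhd⁺ : ∀ {i j y} → i ≢ j → y ∈ B i → y ∈ B j → j ∈ nbhd Γ i
  ∈-nbhd⁺ {i} {j} {y} i≢j y∈Bi y∈Bj = ∈-tabulate⁺ (trans (Γ-blocks i j) adjacent)
    where
    adjacent : blockAdj B i j ≡ true
    adjacent with i ≟ j | nonempty? (B i ∩ B j)
    ... | no _    | yes _     = refl
    ... | yes i≡j | _         = contradiction i≡j i≢j
    ... | no _    | no B∩B≡∅ = contradiction (y , x∈p∩q⁺ (y∈Bi , y∈Bj)) B∩B≡∅

  ∈-nbhd⁻ : ∀ {i j} → j ∈ nbhd Γ i → i ≢ j × Nonempty (B i ∩ B j)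
  ∈-nbhd⁻ {i} {j} j∈ = adjacent (trans (sym (Γ-blocks i j)) (∈-tabulate⁻ j∈))
    where
    adjacent : blockAdj B i j ≡ true → i ≢ j × Nonempty (B i ∩ B j)
    adjacent with i ≟ j | nonempty? (B i ∩ B j)
    ... | no i≢j | yes B∩B≢∅ = λ _ → i≢j , B∩B≢∅
    ... | yes _  | _         = λ ()
    ... | no _   | no _      = λ ()

module Design {v b m} {B : Fin m → Subset v} (design : IsDesign v b m B) where

  block-unique : ∀ {x y i j} → x ≢ y → x ∈ B i → y ∈ B i → x ∈ B j → y ∈ B j → i ≡ j
  block-unique {x} {y} {i} {j} x≢y x∈Bi y∈Bi x∈Bj y∈Bj =
    trans (unique i (∈-tabulate⁺ refl) x∈Bi y∈Bi) (sym (unique j (∈-tabulate⁺ refl) x∈Bj y∈Bj))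
    where unique = proj₂ (proj₂ (IsDesign.pairs design x y x≢y))

  ∣Bi-x∣≡b∸1 : ∀ {i x} → x ∈ B i → ∣ B i - x ∣ ≡ b ∸ 1
  ∣Bi-x∣≡b∸1 {i} x∈Bi = cong (_∸ 1) (trans (sym (∣p∣≡1+∣p-x∣ x∈Bi)) (IsDesign.blockSize design i))

module Switching {v b m} {B : Fin m → Subset v} (design : IsDesign v b m B)
                 {P′ : Subset v} {B′ : Subset m} (sub : IsSubdesign B P′ B′)
                 (Γ : Graph m) (Γ-blocks : ∀ i j → adj Γ i j ≡ blockAdj B i j)
                 {p q : Fin v} (p≢q : p ≢ q)
                 {L : Fin m} (L∈B′ : L ∈ B′) (p∈L : p ∈ B L) (q∈L : q ∈ B L) where

  open Design design
  open BlockGraph Γ Γ-blocks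

  C : Subset m
  C = blocksThrough B B′ p q

  C′ : Subset m
  C′ = blocksThrough B B′ q p

  P′∖L : Subset v
  P′∖L = P′ ─ B L

  ∈C⁻ : ∀ {j} → j ∈ C → j ∈ B′ × p ∈ B j × q ∉ B j
  ∈C⁻ = ∈-blocksThrough⁻ {B = B} {B′} {p} {q}

  in-P′ : ∀ {j y} → j ∈ B′ → y ∈ B j → y ∈ P′
  in-P′ {j} j∈B′ = IsSubdesign.blocksInside sub j j∈B′

  B′-block : ∀ {x y} → x ∈ P′ → y ∈ P′ → x ≢ y → Σ (Fin m) λ k → k ∈ B′ × x ∈ B k × y ∈ B k
  B′-block {x} {y} x∈P′ y∈P′ x≢y =
    let (k , k∋x,y , _) = IsSubdesign.pairs sub x y x∈P′ y∈P′ x≢y in k , k∋x,y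

  ∉L⇒≢p : ∀ {y} → y ∉ B L → y ≢ p
  ∉L⇒≢p y∉L refl = y∉L p∈L

  C⇒≢L : ∀ {j} → j ∈ C → j ≢ L
  C⇒≢L j∈C refl = proj₂ (proj₂ (∈C⁻ j∈C)) q∈L

  C-block-unique : ∀ {y j k} → y ≢ p → j ∈ C → y ∈ B j → k ∈ C → y ∈ B k → j ≡ k
  C-block-unique y≢p j∈C y∈Bj k∈C y∈Bk =
    block-unique y≢p y∈Bj (proj₁ (proj₂ (∈C⁻ j∈C))) y∈Bk (proj₁ (proj₂ (∈C⁻ k∈C)))

  ∈P′∖L⁻ : ∀ {y} → y ∈ P′∖L → y ∈ P′ × y ∉ B L
  ∈P′∖L⁻ y∈ = p─q⊆p P′ (B L) y∈ , x∈p─q⇒x∉q P′ (B L) y∈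

  B′-block-point∈P′∖L : ∀ {j r y} → j ∈ B′ → j ≢ L → r ∈ B j → r ∈ B L → y ∈ B j → y ≢ r → y ∈ P′∖L
  B′-block-point∈P′∖L j∈B′ j≢L r∈Bj r∈L y∈Bj y≢r =
    x∈p∧x∉q⇒x∈p─q (in-P′ j∈B′ y∈Bj) λ y∈L → j≢L (block-unique y≢r y∈Bj r∈Bj y∈L r∈L)

  Bj∩P′∖L≡Bj-r : ∀ {j r} → j ∈ B′ → j ≢ L → r ∈ B j → r ∈ B L → B j ∩ P′∖L ≡ B j - r
  Bj∩P′∖L≡Bj-r {j} {r} j∈B′ j≢L r∈Bj r∈L = ⊆-antisym
    (λ y∈ → let (y∈Bj , y∈P′∖L) = x∈p∩q⁻ (B j) P′∖L y∈ in
      x∈p∧x≢y⇒x∈p-y y∈Bj λ { refl → proj₂ (∈P′∖L⁻ y∈P′∖L) r∈L })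
    (λ y∈ → let y∈Bj = p─q⊆p (B j) _ y∈ in
      x∈p∩q⁺ (y∈Bj , B′-block-point∈P′∖L j∈B′ j≢L r∈Bj r∈L y∈Bj (x∈p-y⇒x≢y y∈)))

  C-block-through : ∀ {y} → y ∈ P′∖L → Σ (Fin m) λ k → k ∈ C × y ∈ B k
  C-block-through {y} y∈ =
    let (y∈P′ , y∉L) = ∈P′∖L⁻ y∈
        (k , k∈B′ , p∈Bk , y∈Bk) = B′-block (in-P′ L∈B′ p∈L) y∈P′ (≢-sym (∉L⇒≢p y∉L))
        q∉Bk = λ q∈Bk → y∉L (subst (λ i → y ∈ B i) (block-unique p≢q p∈Bk q∈Bk p∈L q∈L) y∈Bk)
    in k , ∈-blocksThrough⁺ k∈B′ p∈Bk q∉Bk , y∈Bk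

  ∣C∣*[b∸1]≡∣P′∖L∣ : ∣ C ∣ * (b ∸ 1) ≡ ∣ P′∖L ∣
  ∣C∣*[b∸1]≡∣P′∖L∣ = sym (double-counting B P′∖L C one-C-block b∸1-points)
    where
    one-C-block : ∀ y → y ∈ P′∖L → ∣ pencil B y ∩ C ∣ ≡ 1
    one-C-block y y∈ =
      let (k , k∈C , y∈Bk) = C-block-through y∈
          y≢p = ∉L⇒≢p (proj₂ (∈P′∖L⁻ y∈))
      in ∣p∣≡1 (pencil B y ∩ C) (x∈p∩q⁺ (∈-pencil⁺ B y∈Bk , k∈C)) λ j j∈ →
           let (j∈pencil , j∈C) = x∈p∩q⁻ (pencil B y) C j∈
           in C-block-unique y≢p j∈C (∈-pencil⁻ B j∈pencil) k∈C y∈Bk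
    b∸1-points : ∀ j → j ∈ C → ∣ B j ∩ P′∖L ∣ ≡ b ∸ 1
    b∸1-points j j∈C =
      let (j∈B′ , p∈Bj , _) = ∈C⁻ j∈C
      in trans (cong ∣_∣ (Bj∩P′∖L≡Bj-r j∈B′ (C⇒≢L j∈C) p∈Bj p∈L)) (∣Bi-x∣≡b∸1 p∈Bj)

  ∣Γx∩C∣≡∣Bx∩P′∖L∣ : ∀ {x} → p ∉ B x → ∣ nbhd Γ x ∩ C ∣ ≡ ∣ B x ∩ P′∖L ∣
  ∣Γx∩C∣≡∣Bx∩P′∖L∣ {x} p∉Bx =
    sym (trans (double-counting B (B x ∩ P′∖L) (nbhd Γ x ∩ C) one-block one-point) (*-identityʳ _))
    where
    one-block : ∀ y → y ∈ B x ∩ P′∖L → ∣ pencil B y ∩ (nbhd Γ x ∩ C) ∣ ≡ 1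
    one-block y y∈ =
      let (y∈Bx , y∈P′∖L) = x∈p∩q⁻ (B x) P′∖L y∈
          (k , k∈C , y∈Bk) = C-block-through y∈P′∖L
          x≢k = λ x≡k → p∉Bx (subst (λ i → p ∈ B i) (sym x≡k) (proj₁ (proj₂ (∈C⁻ k∈C))))
      in ∣p∣≡1 (pencil B y ∩ (nbhd Γ x ∩ C))
           (x∈p∩q⁺ (∈-pencil⁺ B y∈Bk , x∈p∩q⁺ (∈-nbhd⁺ x≢k y∈Bx y∈Bk , k∈C))) λ j j∈ →
           let (j∈pencil , j∈Γx∩C) = x∈p∩q⁻ (pencil B y) _ j∈
           in C-block-unique (λ { refl → p∉Bx y∈Bx }) (proj₂ (x∈p∩q⁻ (nbhd Γ x) C j∈Γx∩C))
                             (∈-pencil⁻ B j∈pencil) k∈C y∈Bk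
    one-point : ∀ j → j ∈ nbhd Γ x ∩ C → ∣ B j ∩ (B x ∩ P′∖L) ∣ ≡ 1
    one-point j j∈ =
      let (j∈Γx , j∈C) = x∈p∩q⁻ (nbhd Γ x) C j∈
          (x≢j , y , y∈Bx∩Bj) = ∈-nbhd⁻ j∈Γx
          (y∈Bx , y∈Bj) = x∈p∩q⁻ (B x) (B j) y∈Bx∩Bj
          (j∈B′ , p∈Bj , _) = ∈C⁻ j∈C
          y∈P′∖L = B′-block-point∈P′∖L j∈B′ (C⇒≢L j∈C) p∈Bj p∈L y∈Bj
                     λ y≡p → p∉Bx (subst (_∈ B x) y≡p y∈Bx)
      in ∣p∣≡1 (B j ∩ (B x ∩ P′∖L)) (x∈p∩q⁺ (y∈Bj , x∈p∩q⁺ (y∈Bx , y∈P′∖L))) λ z z∈ →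
           let (z∈Bj , z∈Bx∩P′∖L) = x∈p∩q⁻ (B j) _ z∈
               z∈Bx = proj₁ (x∈p∩q⁻ (B x) P′∖L z∈Bx∩P′∖L)
           in decidable-stable (z ≟ y) λ z≢y → x≢j (block-unique z≢y z∈Bx y∈Bx z∈Bj y∈Bj)

  ∣Γx∩C∣≡∣C∣∸1 : ∀ {x} → x ∈ C → ∣ nbhd Γ x ∩ C ∣ ≡ ∣ C ∣ ∸ 1
  ∣Γx∩C∣≡∣C∣∸1 {x} x∈C = trans (cong ∣_∣ Γx∩C≡C-x) (cong (_∸ 1) (sym (∣p∣≡1+∣p-x∣ x∈C)))
    where
    Γx∩C≡C-x : nbhd Γ x ∩ C ≡ C - x
    Γx∩C≡C-x = ⊆-antisym
      (λ j∈ → let (j∈Γx , j∈C) = x∈p∩q⁻ (nbhd Γ x) C j∈ in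
        x∈p∧x≢y⇒x∈p-y j∈C (≢-sym (proj₁ (∈-nbhd⁻ j∈Γx))))
      (λ j∈ → let j∈C = p─q⊆p C _ j∈ in
        x∈p∩q⁺ (∈-nbhd⁺ (≢-sym (x∈p-y⇒x≢y j∈)) (proj₁ (proj₂ (∈C⁻ x∈C)))
                                              (proj₁ (proj₂ (∈C⁻ j∈C))) , j∈C))

  ∣Γx∩C∣≡b∸1 : ∀ {x} → x ∈ B′ → p ∉ B x → q ∈ B x → ∣ nbhd Γ x ∩ C ∣ ≡ b ∸ 1
  ∣Γx∩C∣≡b∸1 x∈B′ p∉Bx q∈Bx = begin
    ∣ nbhd Γ _ ∩ C ∣ ≡⟨ ∣Γx∩C∣≡∣Bx∩P′∖L∣ p∉Bx ⟩
    ∣ B _ ∩ P′∖L ∣   ≡⟨ cong ∣_∣ (Bj∩P′∖L≡Bj-r x∈B′ (λ { refl → p∉Bx p∈L }) q∈Bx q∈L) ⟩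
    ∣ B _ - q ∣      ≡⟨ ∣Bi-x∣≡b∸1 q∈Bx ⟩
    b ∸ 1            ∎
    where open ≡-Reasoning

  Γx∩C≡C : ∀ {x} → p ∈ B x → q ∈ B x → nbhd Γ x ∩ C ≡ C
  Γx∩C≡C {x} p∈Bx q∈Bx = ⊆-antisym (p∩q⊆q (nbhd Γ x) C) λ j∈C →
    let (_ , p∈Bj , q∉Bj) = ∈C⁻ j∈C
    in x∈p∩q⁺ (∈-nbhd⁺ (λ { refl → q∉Bj q∈Bx }) p∈Bx p∈Bj , j∈C)

  Γx∩[C∪C′]≡C : ∀ {x} → x ∉ B′ → p ∈ B x → nbhd Γ x ∩ (C ∪ C′) ≡ C
  Γx∩[C∪C′]≡C {x} x∉B′ p∈Bx = ⊆-antisym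
    (λ j∈ → let (j∈Γx , j∈C∪C′) = x∈p∩q⁻ (nbhd Γ x) _ j∈ in
      case x∈p∪q⁻ C _ j∈C∪C′ of λ where
        (inj₁ j∈C)  → j∈C
        (inj₂ j∈C′) → contradiction j∈C′ (Γx∩C′-empty j∈Γx))
    (λ j∈C → let (j∈B′ , p∈Bj , _) = ∈C⁻ j∈C in
      x∈p∩q⁺ (∈-nbhd⁺ (λ { refl → x∉B′ j∈B′ }) p∈Bx p∈Bj , x∈p∪q⁺ (inj₁ j∈C)))
    where
    Γx∩C′-empty : ∀ {j} → j ∈ nbhd Γ x → j ∉ C′
    Γx∩C′-empty {j} j∈Γx j∈C′ =
      let (_ , y , y∈Bx∩Bj) = ∈-nbhd⁻ j∈Γx
          (y∈Bx , y∈Bj) = x∈p∩q⁻ (B x) (B j) y∈Bx∩Bj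
          (j∈B′ , _ , p∉Bj) = ∈-blocksThrough⁻ {B = B} {B′} {q} {p} j∈C′
          p≢y = λ p≡y → p∉Bj (subst (_∈ B j) (sym p≡y) y∈Bj)
          (k , k∈B′ , p∈Bk , y∈Bk) = B′-block (in-P′ L∈B′ p∈L) (in-P′ j∈B′ y∈Bj) p≢y
      in x∉B′ (subst (_∈ B′) (sym (block-unique p≢y p∈Bx y∈Bx p∈Bk y∈Bk)) k∈B′)

module SwitchingSet {v b m} {B : Fin m → Subset v} (design : IsDesign v b m B) (2≤b : 2 ≤ b)
                    {P′ : Subset v} {B′ : Subset m} (sub : IsSubdesign B P′ B′)
                    (Γ : Graph m) (Γ-blocks : ∀ i j → adj Γ i j ≡ blockAdj B i j)
                    {p₁ p₂ : Fin v} (p₁≢p₂ : p₁ ≢ p₂)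
                    {L : Fin m} (L∈B′ : L ∈ B′) (p₁∈L : p₁ ∈ B L) (p₂∈L : p₂ ∈ B L) where

  module S₁ = Switching design sub Γ Γ-blocks p₁≢p₂ L∈B′ p₁∈L p₂∈L
  module S₂ = Switching design sub Γ Γ-blocks (≢-sym p₁≢p₂) L∈B′ p₂∈L p₁∈L

  C₁ C₂ : Subset m
  C₁ = S₁.C
  C₂ = S₂.C

  C₁∩C₂≡∅ : Disjoint C₁ C₂
  C₁∩C₂≡∅ x x∈C₁ x∈C₂ = proj₂ (proj₂ (S₁.∈C⁻ x∈C₁)) (proj₁ (proj₂ (S₂.∈C⁻ x∈C₂)))

  ∣C₁∣≡∣C₂∣ : ∣ C₁ ∣ ≡ ∣ C₂ ∣
  ∣C₁∣≡∣C₂∣ = *-cancelʳ-≡ ∣ C₁ ∣ ∣ C₂ ∣ (b ∸ 1) {{≢-nonZero (m>n⇒m∸n≢0 2≤b)}}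
    (trans S₁.∣C∣*[b∸1]≡∣P′∖L∣ (sym S₂.∣C∣*[b∸1]≡∣P′∖L∣))

  C₁-regular : RegularOn Γ C₁ (∣ C₁ ∣ ∸ 1)
  C₁-regular x = S₁.∣Γx∩C∣≡∣C∣∸1

  C₂-regular : RegularOn Γ C₂ (∣ C₁ ∣ ∸ 1)
  C₂-regular x x∈C₂ = trans (S₂.∣Γx∩C∣≡∣C∣∸1 x∈C₂) (cong (_∸ 1) (sym ∣C₁∣≡∣C₂∣))

  C₁∪C₂-regular : RegularOn Γ (C₁ ∪ C₂) ((∣ C₁ ∣ ∸ 1) + (b ∸ 1))
  C₁∪C₂-regular x x∈C₁∪C₂ =
    trans (∣p∩[q∪r]∣≡∣p∩q∣+∣p∩r∣ (nbhd Γ x) C₁ C₂ C₁∩C₂≡∅)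
      (case x∈p∪q⁻ C₁ C₂ x∈C₁∪C₂ of λ where
        (inj₁ x∈C₁) → let (x∈B′ , p₁∈Bx , p₂∉Bx) = S₁.∈C⁻ x∈C₁ in
          cong₂ _+_ (C₁-regular x x∈C₁) (S₂.∣Γx∩C∣≡b∸1 x∈B′ p₂∉Bx p₁∈Bx)
        (inj₂ x∈C₂) → let (x∈B′ , p₂∈Bx , p₁∉Bx) = S₂.∈C⁻ x∈C₂ in
          trans (+-comm ∣ nbhd Γ x ∩ C₁ ∣ _)
                (cong₂ _+_ (C₂-regular x x∈C₂) (S₁.∣Γx∩C∣≡b∸1 x∈B′ p₁∉Bx p₂∈Bx)))

  outside-C₁∪C₂ : ∀ x → x ∉ C₁ ∪ C₂ →
    ∣ nbhd Γ x ∩ C₁ ∣ ≡ ∣ nbhd Γ x ∩ C₂ ∣ ⊎ nbhd Γ x ∩ (C₁ ∪ C₂) ≡ C₁ ⊎ nbhd Γ x ∩ (C₁ ∪ C₂) ≡ C₂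
  outside-C₁∪C₂ x x∉C₁∪C₂ with p₁ ∈? B x | p₂ ∈? B x
  ... | yes p₁∈Bx | yes p₂∈Bx = inj₁ (begin
    ∣ nbhd Γ x ∩ C₁ ∣ ≡⟨ cong ∣_∣ (S₁.Γx∩C≡C p₁∈Bx p₂∈Bx) ⟩
    ∣ C₁ ∣            ≡⟨ ∣C₁∣≡∣C₂∣ ⟩
    ∣ C₂ ∣            ≡⟨ cong ∣_∣ (S₂.Γx∩C≡C p₂∈Bx p₁∈Bx) ⟨
    ∣ nbhd Γ x ∩ C₂ ∣ ∎)
    where open ≡-Reasoning
  ... | no p₁∉Bx  | no p₂∉Bx  =
    inj₁ (trans (S₁.∣Γx∩C∣≡∣Bx∩P′∖L∣ p₁∉Bx) (sym (S₂.∣Γx∩C∣≡∣Bx∩P′∖L∣ p₂∉Bx)))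
  ... | yes p₁∈Bx | no p₂∉Bx  =
    inj₂ (inj₁ (S₁.Γx∩[C∪C′]≡C
      (λ x∈B′ → x∉C₁∪C₂ (x∈p∪q⁺ (inj₁ (∈-blocksThrough⁺ x∈B′ p₁∈Bx p₂∉Bx)))) p₁∈Bx))
  ... | no p₁∉Bx  | yes p₂∈Bx =
    inj₂ (inj₂ (trans (cong (nbhd Γ x ∩_) (∪-comm C₁ C₂))
      (S₂.Γx∩[C∪C′]≡C
        (λ x∈B′ → x∉C₁∪C₂ (x∈p∪q⁺ (inj₂ (∈-blocksThrough⁺ x∈B′ p₂∈Bx p₁∉Bx)))) p₂∈Bx)))

theorem4 : (v b m : ℕ) → 2 ≤ b → (B : Fin m → Subset v) → IsDesign v b m B →
    (P′ : Subset v) (B′ : Subset m) → IsSubdesign B P′ B′ →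
    (p₁ p₂ : Fin v) → p₁ ∈ P′ → p₂ ∈ P′ → p₁ ≢ p₂ →
    (Γ : Graph m) → (∀ i j → adj Γ i j ≡ blockAdj B i j) →
    IsSwitchingSet Γ (blocksThrough B B′ p₁ p₂) (blocksThrough B B′ p₂ p₁)
theorem4 v b m 2≤b B design P′ B′ sub p₁ p₂ p₁∈P′ p₂∈P′ p₁≢p₂ Γ Γ-blocks
  with (L , (L∈B′ , p₁∈L , p₂∈L) , _) ← IsSubdesign.pairs sub p₁ p₂ p₁∈P′ p₂∈P′ p₁≢p₂ =
  C₁∩C₂≡∅ , ∣C₁∣≡∣C₂∣ , (_ , C₁-regular , C₂-regular) , (_ , C₁∪C₂-regular) , outside-C₁∪C₂
  where open SwitchingSet design 2≤b sub Γ Γ-blocks p₁≢p₂ L∈B′ p₁∈L p₂∈L
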